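{- There is a constant $c>0$ such that for every $n\ge 2$ there is a formula $F$ with $\mathsf{AMO}(x_1,\dots,x_n)\rightsquigarrow_{\mathsf{BVA}} F$ and $|F|\le c\,n$; i.e., $|F|=O(n)$.
   Context: A clause is a set of non-complementary literals and a formula is a set of clauses; $|F|$ is the number of clauses. $\mathsf{AMO}(x_1,\dots,x_n) := \bigwedge_{1\le i<j\le n}(\overline{x_i}\lor\overline{x_j})$ (the pairwise at-most-one encoding). Grid product: for a clause $L$ and a set of clauses $\Gamma$, $L\bowtie\Gamma := \{\gamma\cup\{\ell\} : \ell\in L,\ \gamma\in\Gamma\}$. One BVA step: if $F$ contains a subset of the form $L\bowtie\Gamma$, and $y$ is a new variable not occurring in $F$, then $F' := (F\setminus (L\bowtie\Gamma))\cup\{\overline{y}\lor\ell : \ell\in L\}\cup\{y\lor\gamma : \gamma\in\Gamma\}$ is obtainable from $F$ by BVA, written $F\xrightarrow{\mathsf{BVA}}F'$. We write $F\rightsquigarrow_{\mathsf{BVA}} F_k$ if there is a sequence $F\xrightarrow{\mathsf{BVA}}F_1\xrightarrow{\mathsf{BVA}}\cdots\xrightarrow{\mathsf{BVA}}F_k$. -}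

module Defs where

open import Data.Nat using (ℕ; zero; suc; _<_; _+_)
open import Data.Bool using (Bool; true; false; not)
open import Data.Product using (Σ; ∃; ∃-syntax; _×_; _,_)
open import Data.Sum using (_⊎_)
open import Data.List using (List; []; _∷_; _++_; map; concatMap; upTo)
open import Data.List.Membership.Propositional using (_∈_)
open import Data.List.Relation.Unary.All using (All)
open import Data.List.Relation.Unary.Any using (Any)
open import Data.List.Relation.Unary.AllPairs using (AllPairs)
open import Relation.Nullary using (¬_)
open import Relation.Binary.Construct.Closure.ReflexiveTransitive using (Star)

-- A literal is a variable (a natural number) with a polarity:
-- (x , true) is x, (x , false) is the negation of x.
Lit : Set
Lit = ℕ × Bool

neg : Lit → Lit
neg (x , b) = (x , not b)

-- Clauses and formulas are *sets*; we represent them by lists and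
-- compare them extensionally (set semantics).
Clause : Set
Clause = List Lit

Formula : Set
Formula = List Clause

NonComp : Clause → Set
NonComp C = ∀ {ℓ} → ℓ ∈ C → ¬ (neg ℓ ∈ C)

_≋_ : Clause → Clause → Set
C ≋ D = ∀ ℓ → (ℓ ∈ C → ℓ ∈ D) × (ℓ ∈ D → ℓ ∈ C)

_∈F_ : Clause → Formula → Set
C ∈F F = Any (λ D → C ≋ D) F

-- a list faithfully represents a formula (a set of clauses):
-- every entry is a clause, and no clause is listed twice.
-- Then |F| = length F.
WfFormula : Formula → Set
WfFormula F = All NonComp F × AllPairs (λ C D → ¬ (C ≋ D)) F

Occurs : ℕ → Formula → Set
Occurs y F = ∃[ C ] ∃[ b ] (C ∈ F × (y , b) ∈ C)

-- C is an element of the grid product L ⋈ Γ  (γ ∪ {ℓ} = ℓ ∷ γ as a set)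
InGrid : Clause → List Clause → Clause → Set
InGrid L Γ C = ∃[ ℓ ] ∃[ γ ] (ℓ ∈ L × γ ∈ Γ × C ≋ (ℓ ∷ γ))

BVAResult : Formula → Clause → List Clause → ℕ → Clause → Set
BVAResult F L Γ y C =
  (C ∈F F × ¬ InGrid L Γ C)
  ⊎ (∃[ ℓ ] (ℓ ∈ L × C ≋ ((y , false) ∷ ℓ ∷ [])))
  ⊎ (∃[ γ ] (γ ∈ Γ × C ≋ ((y , true) ∷ γ)))

record BVAStep (F F' : Formula) : Set where
  field
    L      : Clause
    Γ      : List Clause
    y      : ℕ
    L-cl   : NonComp L
    Γ-cl   : All NonComp Γ
    Γ-set  : AllPairs (λ C D → ¬ (C ≋ D)) Γ
    fresh  : ¬ Occurs y F
    grid⊆F : ∀ {ℓ γ} → ℓ ∈ L → γ ∈ Γ → (ℓ ∷ γ) ∈F F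
    wf'    : WfFormula F'
    result : ∀ C → (C ∈F F' → BVAResult F L Γ y C)
                 × (BVAResult F L Γ y C → C ∈F F')

_⇝BVA_ : Formula → Formula → Set
_⇝BVA_ = Star BVAStep

-- AMO(x₁,…,xₙ): clauses ¬xᵢ ∨ ¬xⱼ for 1 ≤ i < j ≤ n
AMO : ℕ → Formula
AMO n = concatMap (λ i → map (λ j → (suc i , false) ∷ (suc j , false) ∷ [])
                              (map (λ k → suc i + k) (upTo (n Data.Nat.∸ suc i))))
                  (upTo n)

-- A block N = L ++ M of literals has AMO(N) = AMO(L) ∪ AMO(M) ∪ L ⋈ {{m} : m ∈ M}.
-- One BVA step on that grid with a fresh variable y replaces its |L|·|M| clauses
-- by the |L| + |M| clauses ȳ ∨ ℓ and y ∨ m, and what remains is exactly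
-- AMO(ȳ ∷ L) ∪ AMO(y ∷ M).  Splitting off |L| = 3 literals at a time, the live
-- block y ∷ M loses two literals per step while only the six clauses of
-- AMO(ȳ ∷ L) are set aside, so at most 3n clauses are left in the end.
-- Throughout, the blocks have distinct variables and are pairwise disjoint, which
-- keeps every intermediate list of clauses a set.
module Submission where

open import Defs
open import Data.Nat using (ℕ; _≤_; _<_; _*_)
open import Data.List using (length)
open import Data.Product using (Σ; _×_)

open import Function using (_∘_; id)
open import Data.Nat using (zero; suc; _+_; _∸_; s≤s; z≤n)
open import Data.Nat.Properties using (<-irrefl; <⇒≢; n<1+n; m<n⇒m<1+n; suc-injective; m≤m+n; +-monoˡ-≤; +-identityʳ; ≤-trans; ≤-reflexive)
open import Data.Nat.Tactic.RingSolver using (solve-∀)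
open import Data.Bool using (true; false)
open import Data.Empty using (⊥-elim)
open import Data.Product using (∃; ∃₂; _,_; proj₁; proj₂)
open import Data.Sum using (_⊎_; inj₁; inj₂)
open import Data.List using (List; []; _∷_; _++_; [_]; map; concat; concatMap; applyUpTo; upTo; cartesianProductWith)
open import Data.List.Properties using (map-∘; map-++; map-cong; map-upTo; map-applyUpTo; ++-identityʳ; length-applyUpTo)
open import Data.List.Membership.Propositional using (_∈_; _∉_; find; lose)
open import Data.List.Membership.Propositional.Properties using (∈-map⁺; ∈-map⁻; ∈-++⁺ˡ; ∈-++⁺ʳ; ∈-++⁻; ∈-concat⁻′; ∈-cartesianProductWith⁺; ∈-cartesianProductWith⁻)
open import Data.List.Relation.Unary.Any using (here; there)
open import Data.List.Relation.Unary.All using (All; []; _∷_)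
import Data.List.Relation.Unary.All as All
import Data.List.Relation.Unary.All.Properties as All
open import Data.List.Relation.Unary.AllPairs using (AllPairs; []; _∷_)
import Data.List.Relation.Unary.AllPairs as AllPairs
import Data.List.Relation.Unary.AllPairs.Properties as AllPairs
open import Data.List.Relation.Binary.Subset.Propositional using (_⊆_)
open import Data.List.Relation.Binary.Disjoint.Propositional using (Disjoint)
import Data.List.Relation.Binary.Disjoint.Propositional.Properties as Disjoint
open import Data.List.Relation.Binary.Permutation.Propositional using (_↭_; ↭-refl; ↭-sym; module PermutationReasoning)
open import Data.List.Relation.Binary.Permutation.Propositional.Properties using (∈-resp-↭; ++⁺ˡ; ++⁺ʳ; ++-commutativeMonoid)
open import Algebra.Solver.CommutativeMonoid (++-commutativeMonoid {A = Clause}) using (solve; _⊕_; _⊜_)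
open import Relation.Nullary using (¬_)
open import Relation.Binary.PropositionalEquality using (_≡_; _≢_; refl; sym; trans; cong; subst; module ≡-Reasoning)
open import Relation.Binary.Construct.Closure.ReflexiveTransitive using (ε; _◅_)

var : Lit → ℕ
var = proj₁

neg≢ : ∀ ℓ → neg ℓ ≢ ℓ
neg≢ (_ , true)  ()
neg≢ (_ , false) ()

≋-refl : ∀ {C} → C ≋ C
≋-refl _ = id , id

≋-sym : ∀ {C D} → C ≋ D → D ≋ C
≋-sym C≋D ℓ = proj₂ (C≋D ℓ) , proj₁ (C≋D ℓ)

≋-trans : ∀ {C D E} → C ≋ D → D ≋ E → C ≋ E
≋-trans C≋D D≋E ℓ = proj₁ (D≋E ℓ) ∘ proj₁ (C≋D ℓ) , proj₂ (C≋D ℓ) ∘ proj₂ (D≋E ℓ)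

InGrid-resp-≋ : ∀ {L Γ C D} → C ≋ D → InGrid L Γ C → InGrid L Γ D
InGrid-resp-≋ C≋D (ℓ , γ , ℓ∈L , γ∈Γ , C≋ℓγ) = ℓ , γ , ℓ∈L , γ∈Γ , ≋-trans (≋-sym C≋D) C≋ℓγ

Distinct : Formula → Set
Distinct = AllPairs (λ C D → ¬ C ≋ D)

DistinctVars : List Lit → Set
DistinctVars = AllPairs (λ a b → var a ≢ var b)

distinctVars-injective : ∀ {N a b} → DistinctVars N → a ∈ N → b ∈ N → var a ≡ var b → a ≡ b
distinctVars-injective (_  ∷ _) (here refl) (here refl) _  = refl
distinctVars-injective (px ∷ _) (here refl) (there b∈) eq = ⊥-elim (All.lookup px b∈ eq)
distinctVars-injective (px ∷ _) (there a∈) (here refl) eq = ⊥-elim (All.lookup px a∈ (sym eq))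
distinctVars-injective (_  ∷ d) (there a∈) (there b∈) eq = distinctVars-injective d a∈ b∈ eq

DistinctVars⇒NonComp : ∀ {N} → DistinctVars N → NonComp N
DistinctVars⇒NonComp d {ℓ} ℓ∈ ¬ℓ∈ = neg≢ ℓ (distinctVars-injective d ¬ℓ∈ ℓ∈ refl)

var-fresh⇒∉ : ∀ {x xs} → All (λ z → var x ≢ var z) xs → x ∉ xs
var-fresh⇒∉ px x∈ = All.lookup px x∈ refl

allPairs-++⁻ : ∀ {A : Set} {R : A → A → Set} xs {ys} → AllPairs R (xs ++ ys) →
               AllPairs R xs × AllPairs R ys × All (λ x → All (R x) ys) xs
allPairs-++⁻ []       p        = [] , p , []
allPairs-++⁻ (x ∷ xs) (px ∷ p) with pxs , pys , cross ← allPairs-++⁻ xs p =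
  All.++⁻ˡ xs px ∷ pxs , pys , All.++⁻ʳ xs px ∷ cross

disjoint-++⁻ˡ : ∀ {A : Set} (xs : List A) {ys zs} → Disjoint (xs ++ ys) zs → Disjoint xs zs
disjoint-++⁻ˡ xs xys#zs (v∈xs , v∈zs) = xys#zs (∈-++⁺ˡ v∈xs , v∈zs)

disjoint-++⁻ʳ : ∀ {A : Set} (xs : List A) {ys zs} → Disjoint (xs ++ ys) zs → Disjoint ys zs
disjoint-++⁻ʳ xs xys#zs (v∈ys , v∈zs) = xys#zs (∈-++⁺ʳ xs v∈ys , v∈zs)

distinctVars-++⁻ : ∀ L {M} → DistinctVars (L ++ M) → DistinctVars L × DistinctVars M × Disjoint L M
distinctVars-++⁻ L d with dvL , dvM , L≢M ← allPairs-++⁻ L d =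
  dvL , dvM , λ (ℓ∈L , ℓ∈M) → All.lookup (All.lookup L≢M ℓ∈L) ℓ∈M refl

singleton-≋ : ∀ {a b} → [ a ] ≋ [ b ] → a ≡ b
singleton-≋ {a} eq with proj₁ (eq a) (here refl)
... | here a≡b = a≡b

pair : Lit → Lit → Clause
pair a b = a ∷ b ∷ []

∈-pair⁻ : ∀ {z a b} → z ∈ pair a b → z ≡ a ⊎ z ≡ b
∈-pair⁻ (here z≡a)         = inj₁ z≡a
∈-pair⁻ (there (here z≡b)) = inj₂ z≡b

pair-≋⇒≡ʳ : ∀ {a b c} → pair a b ≋ pair a c → b ≡ c
pair-≋⇒≡ʳ {b = b} {c = c} eq with ∈-pair⁻ (proj₁ (eq b) (there (here refl)))
... | inj₂ b≡c = b≡c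
... | inj₁ refl with ∈-pair⁻ (proj₂ (eq c) (there (here refl)))
...   | inj₁ c≡a = sym c≡a
...   | inj₂ c≡b = sym c≡b

pairs : List Lit → Formula
pairs []       = []
pairs (a ∷ as) = map (pair a) as ++ pairs as

∈-pairs⁻ : ∀ N {D} → D ∈ pairs N → ∃₂ λ a b → a ∈ N × b ∈ N × D ≡ pair a b
∈-pairs⁻ (x ∷ xs) D∈ with ∈-++⁻ (map (pair x) xs) D∈
... | inj₁ D∈row with b , b∈ , refl ← ∈-map⁻ (pair x) D∈row = x , b , here refl , there b∈ , refl
... | inj₂ D∈rest with a , b , a∈ , b∈ , eq ← ∈-pairs⁻ xs D∈rest = a , b , there a∈ , there b∈ , eq

pairs-⊆ : ∀ N {D} → D ∈ pairs N → D ⊆ N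
pairs-⊆ N D∈ z∈D with a , b , a∈ , b∈ , refl ← ∈-pairs⁻ N D∈ with ∈-pair⁻ z∈D
... | inj₁ refl = a∈
... | inj₂ refl = b∈

pairs-NonComp : ∀ {N} → DistinctVars N → All NonComp (pairs N)
pairs-NonComp {N} d = All.tabulate λ D∈ ℓ∈ ¬ℓ∈ →
  DistinctVars⇒NonComp d (pairs-⊆ N D∈ ℓ∈) (pairs-⊆ N D∈ ¬ℓ∈)

pairs-distinct : ∀ {N} → DistinctVars N → Distinct (pairs N)
pairs-distinct {[]}     []        = []
pairs-distinct {x ∷ xs} (px ∷ d) =
  AllPairs.++⁺ (AllPairs.map⁺ (AllPairs.map (λ b≢c → b≢c ∘ cong var ∘ pair-≋⇒≡ʳ) d))
               (pairs-distinct d)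
               (All.tabulate λ C∈ → All.tabulate λ D∈ C≋D → row-vs-rest C∈ D∈ C≋D)
  where
  row-vs-rest : ∀ {C D} → C ∈ map (pair x) xs → D ∈ pairs xs → ¬ C ≋ D
  row-vs-rest C∈ D∈ C≋D with _ , _ , refl ← ∈-map⁻ (pair x) C∈ =
    var-fresh⇒∉ px (pairs-⊆ xs D∈ (proj₁ (C≋D x) (here refl)))

pairs-disjoint : ∀ {B B′} → Disjoint B B′ → All (λ C → All (λ D → ¬ C ≋ D) (pairs B′)) (pairs B)
pairs-disjoint {B} {B′} B#B′ = All.tabulate λ C∈ → All.tabulate λ D∈ C≋D →
  let a , _ , a∈B , _ , C≡ab = ∈-pairs⁻ B C∈
  in B#B′ (a∈B , pairs-⊆ B′ D∈ (proj₁ (C≋D a) (subst (a ∈_) (sym C≡ab) (here refl))))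

_⋈_ : Clause → List Clause → Formula
L ⋈ Γ = cartesianProductWith _∷_ L Γ

pairs-++ : ∀ L M → pairs (L ++ M) ↭ L ⋈ map [_] M ++ pairs L ++ pairs M
pairs-++ []      M = ↭-refl
pairs-++ (x ∷ L) M = begin
  map (pair x) (L ++ M) ++ pairs (L ++ M)
    ≡⟨ cong (_++ pairs (L ++ M)) (map-++ (pair x) L M) ⟩
  (map (pair x) L ++ map (pair x) M) ++ pairs (L ++ M)
    ↭⟨ ++⁺ˡ (map (pair x) L ++ map (pair x) M) (pairs-++ L M) ⟩
  (map (pair x) L ++ map (pair x) M) ++ (L ⋈ map [_] M ++ pairs L ++ pairs M)
    ↭⟨ solve 5 (λ a b c d e → (a ⊕ b) ⊕ (c ⊕ d ⊕ e) ⊜ (b ⊕ c) ⊕ (a ⊕ d) ⊕ e) ↭-refl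
             (map (pair x) L) (map (pair x) M) (L ⋈ map [_] M) (pairs L) (pairs M) ⟩
  (map (pair x) M ++ L ⋈ map [_] M) ++ (map (pair x) L ++ pairs L) ++ pairs M
    ≡⟨ cong (λ G → (G ++ L ⋈ map [_] M) ++ pairs (x ∷ L) ++ pairs M) (map-∘ {g = x ∷_} {f = [_]} M) ⟩
  (x ∷ L) ⋈ map [_] M ++ pairs (x ∷ L) ++ pairs M ∎
  where open PermutationReasoning

pairs-∉grid : ∀ {L M B C} → Disjoint L B ⊎ Disjoint M B → C ∈ pairs B → ¬ InGrid L (map [_] M) C
pairs-∉grid {B = B} L#B⊎M#B C∈ (ℓ , γ , ℓ∈L , γ∈Γ , C≋ℓγ)
  with m , m∈M , refl ← ∈-map⁻ [_] γ∈Γ | L#B⊎M#B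
... | inj₁ L#B = L#B (ℓ∈L , pairs-⊆ B C∈ (proj₂ (C≋ℓγ ℓ) (here refl)))
... | inj₂ M#B = M#B (m∈M , pairs-⊆ B C∈ (proj₂ (C≋ℓγ m) (there (here refl))))

bvaStep : ∀ {F F′ L Γ K y} →
          NonComp L → All NonComp Γ → Distinct Γ → ¬ Occurs y F → WfFormula F′ →
          (∀ {C} → C ∈ K → ¬ InGrid L Γ C) →
          F ↭ L ⋈ Γ ++ K →
          F′ ↭ map (pair (y , false)) L ++ map ((y , true) ∷_) Γ ++ K →
          BVAStep F F′
bvaStep {F} {F′} {L} {Γ} {K} {y} L-cl Γ-cl Γ-set fresh wf′ K∉grid F↭ F′↭ = record
  { L = L ; Γ = Γ ; y = y ; L-cl = L-cl ; Γ-cl = Γ-cl ; Γ-set = Γ-set ; fresh = fresh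
  ; grid⊆F = λ ℓ∈L γ∈Γ → lose (toF (∈-++⁺ˡ (∈-cartesianProductWith⁺ _∷_ ℓ∈L γ∈Γ))) ≋-refl
  ; wf' = wf′
  ; result = λ C → sound , complete
  }
  where
  ȳL yΓ : Formula
  ȳL = map (pair (y , false)) L
  yΓ = map ((y , true) ∷_) Γ

  toF : ∀ {C} → C ∈ L ⋈ Γ ++ K → C ∈ F
  toF = ∈-resp-↭ (↭-sym F↭)

  toF′ : ∀ {C} → C ∈ ȳL ++ yΓ ++ K → C ∈ F′
  toF′ = ∈-resp-↭ (↭-sym F′↭)

  sound : ∀ {C} → C ∈F F′ → BVAResult F L Γ y C
  sound C∈F′ with D , D∈F′ , C≋D ← find C∈F′ with ∈-++⁻ ȳL (∈-resp-↭ F′↭ D∈F′)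
  ... | inj₁ D∈ȳL with ℓ , ℓ∈L , refl ← ∈-map⁻ _ D∈ȳL = inj₂ (inj₁ (ℓ , ℓ∈L , C≋D))
  ... | inj₂ D∈ with ∈-++⁻ yΓ D∈
  ...   | inj₁ D∈yΓ with γ , γ∈Γ , refl ← ∈-map⁻ _ D∈yΓ = inj₂ (inj₂ (γ , γ∈Γ , C≋D))
  ...   | inj₂ D∈K =
    inj₁ (lose (toF (∈-++⁺ʳ (L ⋈ Γ) D∈K)) C≋D , K∉grid D∈K ∘ InGrid-resp-≋ C≋D)

  complete : ∀ {C} → BVAResult F L Γ y C → C ∈F F′
  complete (inj₁ (C∈F , C∉grid)) with D , D∈F , C≋D ← find C∈F with ∈-++⁻ (L ⋈ Γ) (∈-resp-↭ F↭ D∈F)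
  ... | inj₁ D∈grid with ℓ , γ , ℓ∈L , γ∈Γ , refl ← ∈-cartesianProductWith⁻ _∷_ L Γ D∈grid =
    ⊥-elim (C∉grid (ℓ , γ , ℓ∈L , γ∈Γ , C≋D))
  ... | inj₂ D∈K = lose (toF′ (∈-++⁺ʳ ȳL (∈-++⁺ʳ yΓ D∈K))) C≋D
  complete (inj₂ (inj₁ (ℓ , ℓ∈L , C≋))) = lose (toF′ (∈-++⁺ˡ (∈-map⁺ _ ℓ∈L))) C≋
  complete (inj₂ (inj₂ (γ , γ∈Γ , C≋))) = lose (toF′ (∈-++⁺ʳ ȳL (∈-++⁺ˡ (∈-map⁺ _ γ∈Γ)))) C≋

Below : ℕ → List Lit → Set
Below y = All (λ ℓ → var ℓ < y)

below-∉ : ∀ {y s B} → Below y B → (y , s) ∉ B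
below-∉ below y∈ = <-irrefl refl (All.lookup below y∈)

below-var-fresh : ∀ {y B} → Below y B → All (λ b → y ≢ var b) B
below-var-fresh = All.map λ b<y y≡b → <-irrefl (sym y≡b) b<y

below-∷ : ∀ {y s B} → Below y B → Below (suc y) ((y , s) ∷ B)
below-∷ {y} below = n<1+n y ∷ All.map m<n⇒m<1+n below

below-∷-disjoint : ∀ {y s M B} → Below y B → Disjoint M B → Disjoint ((y , s) ∷ M) B
below-∷-disjoint below M#B (here refl , y∈B) = below-∉ below y∈B
below-∷-disjoint below M#B (there m∈M , m∈B) = M#B (m∈M , m∈B)

∈-blocks⁻ : ∀ Bs {C} → C ∈ concatMap pairs Bs → ∃ λ B → B ∈ Bs × C ∈ pairs B
∈-blocks⁻ Bs C∈ with _ , C∈P , P∈ ← ∈-concat⁻′ (map pairs Bs) C∈ with B , B∈ , refl ← ∈-map⁻ pairs P∈ =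
  B , B∈ , C∈P

blocks-wf : ∀ {Bs} → All DistinctVars Bs → AllPairs Disjoint Bs → WfFormula (concatMap pairs Bs)
blocks-wf dv disj =
  All.concat⁺ (All.map⁺ (All.map pairs-NonComp dv)) ,
  AllPairs.concat⁺ (All.map⁺ (All.map pairs-distinct dv)) (AllPairs.map⁺ (AllPairs.map pairs-disjoint disj))

blocks-fresh : ∀ {Bs y} → All (Below y) Bs → ¬ Occurs y (concatMap pairs Bs)
blocks-fresh {Bs} below (C , _ , C∈ , y∈C) with B , B∈ , C∈B ← ∈-blocks⁻ Bs C∈ =
  below-∉ (All.lookup below B∈) (pairs-⊆ B C∈B y∈C)

-- The current formula is concatMap pairs Bs, the union of AMO over the blocks Bs.
record Invariant (Bs : List (List Lit)) (y : ℕ) : Set where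
  field
    distinctVars : All DistinctVars Bs
    disjoint     : AllPairs Disjoint Bs
    below        : All (Below y) Bs

module Split (L M : List Lit) {Bs : List (List Lit)} {y : ℕ} (I : Invariant ((L ++ M) ∷ Bs) y) where
  open Invariant I

  y⁺ y⁻ : Lit
  y⁺ = y , true
  y⁻ = y , false

  private
    dvL : DistinctVars L
    dvL = proj₁ (distinctVars-++⁻ L (All.head distinctVars))

    dvM : DistinctVars M
    dvM = proj₁ (proj₂ (distinctVars-++⁻ L (All.head distinctVars)))

    L#M : Disjoint L M
    L#M = proj₂ (proj₂ (distinctVars-++⁻ L (All.head distinctVars)))

    belowL : Below y L
    belowL = All.++⁻ˡ L (All.head below)

    belowM : Below y M
    belowM = All.++⁻ʳ L (All.head below)

    LM#Bs : All (Disjoint (L ++ M)) Bs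
    LM#Bs = AllPairs.head disjoint

    L#Bs : All (Disjoint L) Bs
    L#Bs = All.map (disjoint-++⁻ˡ L) LM#Bs

    M#Bs : All (Disjoint M) Bs
    M#Bs = All.map (disjoint-++⁻ʳ L) LM#Bs

    y⁺M#y⁻L : Disjoint (y⁺ ∷ M) (y⁻ ∷ L)
    y⁺M#y⁻L (here refl  , there y∈L) = below-∉ belowL y∈L
    y⁺M#y⁻L (there m∈M , here refl)  = below-∉ belowM m∈M
    y⁺M#y⁻L (there m∈M , there m∈L) = L#M (m∈L , m∈M)

    fresh-∷-disjoint : ∀ {s N} → All (Disjoint N) Bs → All (Disjoint ((y , s) ∷ N)) Bs
    fresh-∷-disjoint N#Bs =
      All.tabulate λ B∈ → below-∷-disjoint (All.lookup (All.tail below) B∈) (All.lookup N#Bs B∈)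

  invariant : Invariant ((y⁺ ∷ M) ∷ (y⁻ ∷ L) ∷ Bs) (suc y)
  invariant = record
    { distinctVars = (below-var-fresh belowM ∷ dvM) ∷ (below-var-fresh belowL ∷ dvL) ∷ All.tail distinctVars
    ; disjoint     = (y⁺M#y⁻L ∷ fresh-∷-disjoint M#Bs) ∷ fresh-∷-disjoint L#Bs ∷ AllPairs.tail disjoint
    ; below        = below-∷ belowM ∷ below-∷ belowL ∷ All.map (All.map m<n⇒m<1+n) (All.tail below)
    }

  private
    R : Formula
    R = concatMap pairs Bs

    K : Formula
    K = pairs L ++ pairs M ++ R

    K∉grid : ∀ {C} → C ∈ K → ¬ InGrid L (map [_] M) C
    K∉grid C∈ with ∈-++⁻ (pairs L) C∈
    ... | inj₁ C∈L = pairs-∉grid (inj₂ (Disjoint.sym L#M)) C∈L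
    ... | inj₂ C∈ with ∈-++⁻ (pairs M) C∈
    ...   | inj₁ C∈M = pairs-∉grid (inj₁ L#M) C∈M
    ...   | inj₂ C∈R with B , B∈ , C∈B ← ∈-blocks⁻ Bs C∈R = pairs-∉grid (inj₁ (All.lookup L#Bs B∈)) C∈B

    before : concatMap pairs ((L ++ M) ∷ Bs) ↭ L ⋈ map [_] M ++ K
    before = begin
      pairs (L ++ M) ++ R
        ↭⟨ ++⁺ʳ R (pairs-++ L M) ⟩
      (L ⋈ map [_] M ++ pairs L ++ pairs M) ++ R
        ↭⟨ solve 4 (λ a b c d → (a ⊕ b ⊕ c) ⊕ d ⊜ a ⊕ b ⊕ c ⊕ d) ↭-refl (L ⋈ map [_] M) (pairs L) (pairs M) R ⟩
      L ⋈ map [_] M ++ K ∎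
      where open PermutationReasoning

    after : concatMap pairs ((y⁺ ∷ M) ∷ (y⁻ ∷ L) ∷ Bs) ↭ map (pair y⁻) L ++ map (y⁺ ∷_) (map [_] M) ++ K
    after = begin
      (map (pair y⁺) M ++ pairs M) ++ (map (pair y⁻) L ++ pairs L) ++ R
        ≡⟨ cong (λ G → (G ++ pairs M) ++ (map (pair y⁻) L ++ pairs L) ++ R) (map-∘ {g = y⁺ ∷_} {f = [_]} M) ⟩
      (map (y⁺ ∷_) (map [_] M) ++ pairs M) ++ (map (pair y⁻) L ++ pairs L) ++ R
        ↭⟨ solve 5 (λ a b c d e → (a ⊕ b) ⊕ (c ⊕ d) ⊕ e ⊜ c ⊕ a ⊕ d ⊕ b ⊕ e) ↭-refl
                 (map (y⁺ ∷_) (map [_] M)) (pairs M) (map (pair y⁻) L) (pairs L) R ⟩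
      map (pair y⁻) L ++ map (y⁺ ∷_) (map [_] M) ++ K ∎
      where open PermutationReasoning

  step : BVAStep (concatMap pairs ((L ++ M) ∷ Bs)) (concatMap pairs ((y⁺ ∷ M) ∷ (y⁻ ∷ L) ∷ Bs))
  step = bvaStep (DistinctVars⇒NonComp dvL)
                 (All.map⁺ (All.tabulate λ _ → DistinctVars⇒NonComp ([] ∷ [])))
                 (AllPairs.map⁺ (AllPairs.map (λ a≢b → a≢b ∘ cong var ∘ singleton-≋) dvM))
                 (blocks-fresh below)
                 (blocks-wf (Invariant.distinctVars invariant) (Invariant.disjoint invariant))
                 K∉grid before after

ReducibleWithin : Formula → ℕ → Set
ReducibleWithin F k = Σ Formula λ F′ → (F ⇝BVA F′) × (length F′ ≤ k)

block-reducible : ∀ h M {Bs y} → Invariant ((h ∷ M) ∷ Bs) y →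
                  ReducibleWithin (concatMap pairs ((h ∷ M) ∷ Bs))
                                  (3 * length (h ∷ M) + length (concatMap pairs Bs))
block-reducible h []                _ = _ , ε , +-monoˡ-≤ _ z≤n
block-reducible h (b ∷ [])          _ = _ , ε , +-monoˡ-≤ _ (m≤m+n 1 5)
block-reducible h (b ∷ c ∷ [])      _ = _ , ε , +-monoˡ-≤ _ (m≤m+n 3 6)
block-reducible h (b ∷ c ∷ d ∷ [])  _ = _ , ε , +-monoˡ-≤ _ (m≤m+n 6 6)
block-reducible h (b ∷ c ∷ d ∷ e ∷ M) {Bs} {y} I
  with F , steps , size ←
         block-reducible (y , true) (d ∷ e ∷ M) (Split.invariant (h ∷ b ∷ c ∷ []) (d ∷ e ∷ M) I) =
  F , Split.step (h ∷ b ∷ c ∷ []) (d ∷ e ∷ M) I ◅ steps ,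
  ≤-trans size (≤-reflexive (shrink (length M) (length (concatMap pairs Bs))))
  where
  shrink : ∀ m r → 3 * (3 + m) + (6 + r) ≡ 3 * (5 + m) + r
  shrink = solve-∀

-- x̄ i is the literal ¬x_{i+1}, so that AMO n speaks about x̄ 0, …, x̄ (n ∸ 1).
x̄ : ℕ → Lit
x̄ i = suc i , false

pairs-applyUpTo : ∀ (g : ℕ → Lit) n →
  pairs (applyUpTo g n) ≡ concat (applyUpTo (λ i → map (pair (g i)) (applyUpTo (λ k → g (suc i + k)) (n ∸ suc i))) n)
pairs-applyUpTo g zero    = refl
pairs-applyUpTo g (suc n) = cong (map (pair (g 0)) (applyUpTo (g ∘ suc) n) ++_) (pairs-applyUpTo (g ∘ suc) n)

AMO≡pairs : ∀ n → AMO n ≡ pairs (applyUpTo x̄ n)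
AMO≡pairs n = begin
  AMO n                     ≡⟨ cong concat (map-cong row≡ (upTo n)) ⟩
  concat (map row (upTo n)) ≡⟨ cong concat (map-upTo row n) ⟩
  concat (applyUpTo row n)  ≡⟨ pairs-applyUpTo x̄ n ⟨
  pairs (applyUpTo x̄ n)     ∎
  where
  open ≡-Reasoning

  row : ℕ → Formula
  row i = map (pair (x̄ i)) (applyUpTo (λ k → x̄ (suc i + k)) (n ∸ suc i))

  row≡ : ∀ i → map (λ j → pair (x̄ i) (x̄ j)) (map (suc i +_) (upTo (n ∸ suc i))) ≡ row i
  row≡ i = trans (sym (map-∘ (upTo (n ∸ suc i))))
                 (trans (map-upTo _ (n ∸ suc i)) (sym (map-applyUpTo _ (pair (x̄ i)) (n ∸ suc i))))

initial-invariant : ∀ n → Invariant (applyUpTo x̄ n ∷ []) (suc n)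
initial-invariant n = record
  { distinctVars = AllPairs.applyUpTo⁺₁ x̄ n (λ i<j _ → <⇒≢ i<j ∘ suc-injective) ∷ []
  ; disjoint     = [] ∷ []
  ; below        = All.applyUpTo⁺₁ x̄ n s≤s ∷ []
  }

amo-reducible : ∀ n → ReducibleWithin (AMO n) (3 * n)
amo-reducible zero = [] , ε , z≤n
amo-reducible (suc n)
  with F , steps , size ← block-reducible (x̄ 0) (applyUpTo (x̄ ∘ suc) n) (initial-invariant (suc n)) =
  F , subst (_⇝BVA F) start steps , ≤-trans size (≤-reflexive bound)
  where
  start : concatMap pairs (applyUpTo x̄ (suc n) ∷ []) ≡ AMO (suc n)
  start = trans (++-identityʳ _) (sym (AMO≡pairs (suc n)))

  bound : 3 * length (applyUpTo x̄ (suc n)) + 0 ≡ 3 * suc n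
  bound = trans (+-identityʳ _) (cong (3 *_) (length-applyUpTo x̄ (suc n)))

proposition15 : Σ ℕ (λ c → (0 < c) × ((n : ℕ) → 2 ≤ n → Σ Formula (λ F → (AMO n ⇝BVA F) × (length F ≤ c * n))))
proposition15 = 3 , s≤s z≤n , λ n _ → amo-reducible n
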